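{- Let $f\in\omega^{\subset\omega}$, let $k,n\geq 1$, and let $U$ be a $(k(n-1)+1)$-branching set of extensions of $f$ with $U=\bigcup_{i<k}U_i$. Then for some $i<k$, $U_i$ contains an $n$-branching set of extensions of $f$.
   Context: $\omega^{\subset\omega}$ denotes the set of partial functions from $\omega$ to $\omega$ with finite domain. For $f\in\omega^{\subset\omega}$, an $n$-branching set of extensions of $f$ of length $k\geq 1$ is defined by induction on $k$: an $n$-branching set of extensions of $f$ of length $1$ is a set $U$ of $n$ functions such that for some fixed $x\notin\operatorname{dom}(f)$, every $g\in U$ satisfies $f\subseteq g$ and $\operatorname{dom}(g)=\operatorname{dom}(f)\cup\{x\}$; if $U_0$ is an $n$-branching set of extensions of $f$ of length $k$ and for each $g\in U_0$, $U_g$ is an $n$-branching set of extensions of $g$ of length $1$, then $\bigcup_{g\in U_0}U_g$ is an $n$-branching set of extensions of $f$ of length $k+1$. An $n$-branching set of extensions of $f$ is one of some length $k\geq1$. -}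

module Defs where

open import Data.Nat using (ℕ; zero; suc)
open import Data.Maybe using (Maybe; just; nothing)
open import Data.Fin using (Fin)
open import Data.Product using (Σ; ∃; _×_; _,_)
open import Data.Sum using (_⊎_)
open import Relation.Binary.PropositionalEquality using (_≡_)
open import Relation.Nullary using (¬_)
open import Level using (0ℓ)

-- Finite partial functions ω → ω, in a canonical representation so that
-- propositional equality (≡) coincides with equality of partial functions.
-- A nonempty table lists the values at 0,1,2,... and its LAST entry is defined.
data NETable : Set where
  lastEntry : ℕ → NETable
  consEntry : Maybe ℕ → NETable → NETable

data PFun : Set where
  ∅  : PFun
  ne : NETable → PFun

appNE : NETable → ℕ → Maybe ℕ
appNE (lastEntry v) zero = just v
appNE (lastEntry v) (suc x) = nothing
appNE (consEntry m r) zero = m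
appNE (consEntry m r) (suc x) = appNE r x

app : PFun → ℕ → Maybe ℕ
app ∅ x = nothing
app (ne r) x = appNE r x

InDom : PFun → ℕ → Set
InDom f x = ∃ λ y → app f x ≡ just y

_⊑_ : PFun → PFun → Set
f ⊑ g = ∀ x y → app f x ≡ just y → app g x ≡ just y

PSet : Set₁
PSet = PFun → Set

_⊆ˢ_ : PSet → PSet → Set
U ⊆ˢ V = ∀ h → U h → V h

_≐_ : PSet → PSet → Set
U ≐ V = (U ⊆ˢ V) × (V ⊆ˢ U)

HasSize : ℕ → PSet → Set
HasSize n U = Σ (Fin n → PFun) λ g →
  (∀ i j → g i ≡ g j → i ≡ j) × (∀ h → (U h → ∃ λ i → g i ≡ h) × ((∃ λ i → g i ≡ h) → U h))

Branching1 : PFun → ℕ → PSet → Set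
Branching1 f n U = ∃ λ x → ¬ InDom f x × HasSize n U ×
  (∀ g → U g → (f ⊑ g) × (∀ z → (InDom g z → InDom f z ⊎ z ≡ x) × (InDom f z ⊎ z ≡ x → InDom g z)))

data Branching (f : PFun) (n : ℕ) : ℕ → PSet → Set₁ where
  base : ∀ {U} → Branching1 f n U → Branching f n 1 U
  step : ∀ {k U} (U₀ : PSet) (V : PFun → PSet) →
         Branching f n k U₀ →
         (∀ g → U₀ g → Branching1 g n (V g)) →
         U ≐ (λ h → ∃ λ g → U₀ g × V g h) →
         Branching f n (suc k) U

IsBranching : PFun → ℕ → PSet → Set₁
IsBranching f n U = ∃ λ k → Branching f n k U

ContainsBranching : PFun → ℕ → PSet → Set₁
ContainsBranching f n W = ∃ λ U → IsBranching f n U × (U ⊆ˢ W)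

-- A one-step set of
-- k(n-1)+1 extensions, covered by k sets, has n members in one of them by the
-- pigeonhole principle. For a longer set U = ⋃_{g ∈ U₀} V_g, colour each g ∈ U₀
-- by an i such that V_g has n members in U_i; by induction U₀ contains an
-- n-branching set W₀ of one colour i, and grafting onto each g ∈ W₀ its n
-- extensions in U_i gives an n-branching set inside U_i.
module Submission where

open import Defs
open import Data.Nat using (ℕ; _+_; _*_; _∸_; _≤_)
open import Data.Fin using (Fin)
open import Data.Product using (∃; _×_)

open import Data.Nat using (suc; _<_; s≤s; z≤n; _<?_)
open import Data.Nat.Properties as ℕ
  using (≮⇒≥; <-≤-trans; +-cancelˡ-<; +-monoˡ-≤; +-suc; m<m+n)
open import Data.Fin using (zero; suc; inject≤)
open import Data.Fin.Properties as Fin using (inject≤-injective)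
open import Data.Maybe.Properties using (≡-dec)
open import Data.Product using (Σ; _,_; proj₁; proj₂)
open import Data.List using (List; []; _∷_; length; filter; lookup; tabulate; allFin; concatMap)
open import Data.List.Properties using (length-tabulate)
open import Data.List.Relation.Unary.All as All using (All; _∷_)
open import Data.List.Relation.Unary.All.Properties as All using (all-filter)
open import Data.List.Relation.Unary.AllPairs using (_∷_)
open import Data.List.Relation.Unary.Any using (here; there)
open import Data.List.Relation.Unary.Unique.Propositional using (Unique)
import Data.List.Relation.Unary.Unique.Propositional.Properties as Unique
open import Data.List.Relation.Binary.Sublist.Propositional.Properties
  using (filter-⊆; filter⁺; length-mono-≤)
open import Data.List.Membership.Propositional using (_∈_)
open import Data.List.Membership.Propositional.Properties
  using (∈-lookup; ∈-allFin; ∈-tabulate⁺; ∈-tabulate⁻; >>=-∈↔)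
open import Function using (id; _∘_; Inverse)
open import Function.Definitions using (Injective)
open import Relation.Nullary using (Dec; yes; no; ¬?; contradiction)
open import Relation.Binary.Definitions using (DecidableEquality)
open import Relation.Binary.PropositionalEquality using (_≡_; refl; sym; trans; cong; subst; subst₂)

_≟ᵀ_ : DecidableEquality NETable
lastEntry a ≟ᵀ lastEntry b with a ℕ.≟ b
... | yes refl = yes refl
... | no a≢b = no λ { refl → a≢b refl }
lastEntry _ ≟ᵀ consEntry _ _ = no λ ()
consEntry _ _ ≟ᵀ lastEntry _ = no λ ()
consEntry x r ≟ᵀ consEntry y s with ≡-dec ℕ._≟_ x y | r ≟ᵀ s
... | yes refl | yes refl = yes refl
... | no x≢y | _ = no λ { refl → x≢y refl }
... | yes _ | no r≢s = no λ { refl → r≢s refl }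

_≟ᴾ_ : DecidableEquality PFun
∅ ≟ᴾ ∅ = yes refl
∅ ≟ᴾ ne _ = no λ ()
ne _ ≟ᴾ ∅ = no λ ()
ne r ≟ᴾ ne s with r ≟ᵀ s
... | yes refl = yes refl
... | no r≢s = no λ { refl → r≢s refl }

open import Data.List.Membership.DecPropositional _≟ᴾ_ using (_∈?_)

module _ {A : Set} where

  length-filter-split : ∀ {P : A → Set} (P? : ∀ x → Dec (P x)) xs →
    length xs ≡ length (filter P? xs) + length (filter (¬? ∘ P?) xs)
  length-filter-split P? [] = refl
  length-filter-split P? (x ∷ xs) with P? x
  ... | yes _ = cong suc (length-filter-split P? xs)
  ... | no _ = trans (cong suc (length-filter-split P? xs)) (sym (+-suc _ _))

  lookup-injective : {xs : List A} → Unique xs → Injective _≡_ _≡_ (lookup xs)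
  lookup-injective {_ ∷ _} _ {zero} {zero} _ = refl
  lookup-injective {_ ∷ _} (x∉ ∷ _) {zero} {suc j} x≡ = contradiction x≡ (All.lookup x∉ (∈-lookup j))
  lookup-injective {_ ∷ _} (x∉ ∷ _) {suc i} {zero} ≡x = contradiction (sym ≡x) (All.lookup x∉ (∈-lookup i))
  lookup-injective {_ ∷ _} (_ ∷ u) {suc i} {suc j} eq = cong suc (lookup-injective u eq)

pigeonhole : ∀ {A C : Set} (_≟_ : DecidableEquality C) (c : A → C) (cs : List C) m (xs : List A) →
  All (λ x → c x ∈ cs) xs → length cs * m < length xs →
  ∃ λ i → m < length (filter (λ x → c x ≟ i) xs)
pigeonhole _≟_ c [] m (x ∷ _) (() ∷ _) _
pigeonhole _≟_ c (i ∷ cs) m xs cs∋c |xs|> with m <? length (filter P? xs)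
  where P? = λ x → c x ≟ i
... | yes many = i , many
... | no few =
  let j , many = pigeonhole _≟_ c cs m rest cs∋c-rest |rest|>
  in j , <-≤-trans many
           (length-mono-≤ (filter⁺ (λ x → c x ≟ j) (λ x → c x ≟ j) (λ { refl p → p }) (filter-⊆ _ xs)))
  where
  P? = λ x → c x ≟ i
  rest = filter (¬? ∘ P?) xs
  cs∋c-rest : All (λ x → c x ∈ cs) rest
  cs∋c-rest = All.zipWith (λ { (here c≡i , c≢i) → contradiction c≡i c≢i ; (there c∈ , _) → c∈ })
                (All.filter⁺ _ cs∋c , all-filter _ xs)
  |rest|> : length cs * m < length rest
  |rest|> = +-cancelˡ-< m _ _ (begin-strict
    m + length cs * m                           <⟨ |xs|> ⟩
    length xs                                   ≡⟨ length-filter-split P? xs ⟩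
    length (filter P? xs) + length rest         ≤⟨ +-monoˡ-≤ (length rest) (≮⇒≥ few) ⟩
    m + length rest                             ∎)
    where open ℕ.≤-Reasoning

pigeonhole-Fin : ∀ {N k} m (c : Fin N → Fin k) → k * m < N →
  ∃ λ i → Σ (Fin (suc m) → Fin N) λ s → Injective _≡_ _≡_ s × (∀ j → c (s j) ≡ i)
pigeonhole-Fin {N} {k} m c k*m<N =
  let i , m<|ys| = pigeonhole Fin._≟_ c (allFin k) m (allFin N) (All.tabulate λ _ → ∈-allFin _)
                     (subst₂ (λ a b → a * m < b) (sym (|allFin| k)) (sym (|allFin| N)) k*m<N)
  in i , (λ j → lookup (ys i) (inject≤ j m<|ys|)) ,
     (λ eq → inject≤-injective _ _ _ _ (lookup-injective (Unique.filter⁺ _ (Unique.allFin⁺ N)) eq)) ,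
     (λ j → All.lookup (all-filter (λ x → c x Fin.≟ i) (allFin N)) (∈-lookup _))
  where
  |allFin| : ∀ n → length (allFin n) ≡ n
  |allFin| n = length-tabulate id
  ys : Fin k → List (Fin N)
  ys i = filter (λ x → c x Fin.≟ i) (allFin N)

⋃ : ∀ {k} → (Fin k → PSet) → PSet
⋃ Us h = ∃ λ i → Us i h

Branching1In : PFun → ℕ → PSet → Set
Branching1In g n W = ∃ λ L → Branching1 g n (_∈ L) × All W L

BranchingIn : PFun → ℕ → ℕ → PSet → Set₁
BranchingIn f n K W = ∃ λ L → Branching f n K (_∈ L) × All W L

HasSize-tabulate : ∀ {n} {e : Fin n → PFun} → Injective _≡_ _≡_ e → HasSize n (_∈ tabulate e)
HasSize-tabulate {e = e} e-inj =
  e , (λ _ _ → e-inj) ,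
  λ h → (λ h∈ → let j , h≡ej = ∈-tabulate⁻ h∈ in j , sym h≡ej) , λ { (j , refl) → ∈-tabulate⁺ j }

Branching1-⊆ : ∀ {g N n V W} → Branching1 g N V → HasSize n W → W ⊆ˢ V → Branching1 g n W
Branching1-⊆ (x , x∉dom , _ , extends) W-size W⊆V = x , x∉dom , W-size , λ h → extends h ∘ W⊆V h

monochromatic-extensions : ∀ {g k V} m (Us : Fin k → PSet) →
  Branching1 g (k * m + 1) V → V ⊆ˢ ⋃ Us → ∃ λ i → Branching1In g (suc m) (Us i)
monochromatic-extensions {g} {k} {V} m Us b@(_ , _ , (en , en-inj , en-enum) , _) V⊆⋃Us =
  let i , s , s-inj , s-colour = pigeonhole-Fin m colour (m<m+n (k * m) (s≤s z≤n))
      e = en ∘ s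
  in i , tabulate e ,
     Branching1-⊆ {g} b (HasSize-tabulate (s-inj ∘ en-inj _ _))
                  (λ _ → All.lookup (All.tabulate⁺ {f = e} (V∋en ∘ s))) ,
     All.tabulate⁺ {f = e} (λ j → subst (λ i → Us i (e j)) (s-colour j) (proj₂ (V⊆⋃Us (e j) (V∋en (s j)))))
  where
  V∋en : ∀ j → V (en j)
  V∋en j = proj₂ (en-enum (en j)) (j , refl)
  colour : Fin (k * m + 1) → Fin k
  colour j = proj₁ (V⊆⋃Us (en j) (V∋en j))

module _ {n} {W : PSet} {L₀ : List PFun} (exts : All (λ g → Branching1In g n W) L₀) where

  -- The extensions grafted onto g may not depend on the proof of g ∈ L₀, so
  -- they are read off at the occurrence of g found by _∈?_.
  chosenExtensions : ∀ g → Dec (g ∈ L₀) → List PFun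
  chosenExtensions g (yes g∈L₀) = proj₁ (All.lookup exts g∈L₀)
  chosenExtensions g (no _) = []

  chosenExtensions-spec : ∀ g (g∈L₀? : Dec (g ∈ L₀)) → g ∈ L₀ →
    Branching1 g n (_∈ chosenExtensions g g∈L₀?) × All W (chosenExtensions g g∈L₀?)
  chosenExtensions-spec g (yes g∈L₀) _ = proj₂ (All.lookup exts g∈L₀)
  chosenExtensions-spec g (no g∉L₀) g∈L₀ = contradiction g∈L₀ g∉L₀

  extensionsOf : PFun → List PFun
  extensionsOf g = chosenExtensions g (g ∈? L₀)

  graft : ∀ {f K} → Branching f n K (_∈ L₀) → BranchingIn f n (suc K) W
  graft b =
    concatMap extensionsOf L₀ ,
    step (_∈ L₀) (λ g → _∈ extensionsOf g) b (λ g → proj₁ ∘ spec g)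
         ((λ _ → Inverse.from >>=-∈↔) , (λ _ → Inverse.to >>=-∈↔)) ,
    All.tabulate (λ h∈ → let g , g∈L₀ , h∈exts = Inverse.from >>=-∈↔ h∈
                         in All.lookup (proj₂ (spec g g∈L₀)) h∈exts)
    where
    spec : ∀ g → g ∈ L₀ → Branching1 g n (_∈ extensionsOf g) × All W (extensionsOf g)
    spec g = chosenExtensions-spec g (g ∈? L₀)

monochromatic-branching : ∀ {f k K U} m (Us : Fin k → PSet) →
  Branching f (k * m + 1) K U → U ⊆ˢ ⋃ Us → ∃ λ i → BranchingIn f (suc m) K (Us i)
monochromatic-branching {f} m Us (base b) U⊆⋃Us =
  let i , L , bL , Usᵢ∋L = monochromatic-extensions {f} m Us b U⊆⋃Us
  in i , L , base bL , Usᵢ∋L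
monochromatic-branching m Us (step U₀ V b₀ bV (_ , ⋃V⊆U)) U⊆⋃Us =
  let i , L₀ , bL₀ , exts = monochromatic-branching m (λ i g → Branching1In g (suc m) (Us i)) b₀
                              (λ g u → monochromatic-extensions {g} m Us (bV g u)
                                         (λ h v → U⊆⋃Us h (⋃V⊆U h (g , u , v))))
  in i , graft exts bL₀

mainTheorem2 : (f : PFun) (k n : ℕ) → 1 ≤ k → 1 ≤ n →
    (U : PSet) → IsBranching f (k * (n ∸ 1) + 1) U →
    (Us : Fin k → PSet) → U ≐ (λ h → ∃ λ i → Us i h) →
    ∃ λ i → ContainsBranching f n (Us i)
mainTheorem2 f k (suc m) _ _ U (K , b) Us (U⊆⋃Us , _) =
  let i , L , bL , Usᵢ∋L = monochromatic-branching m Us b U⊆⋃Us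
  in i , (_∈ L) , (K , bL) , λ _ → All.lookup Usᵢ∋L
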